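{- For any integers $m,k\ge 2$, $5\le g(P_m\boxtimes C_{2k+1})\le 6$.
   Context: $P_m$ is the path of order $m$ and $C_{2k+1}$ the cycle of order $2k+1$. For a connected graph, $I[x,y]$ consists of $x$, $y$ and all vertices on some shortest $x$–$y$ path; $I[S]=\bigcup_{u,v\in S}I[u,v]$; $S$ is geodetic if $I[S]$ is the whole vertex set, and $g(\cdot)$ is the minimum cardinality of a geodetic set. The strong product $G\boxtimes H$ has vertex set $V(G)\times V(H)$, with $(g,h)$ and $(g',h')$ adjacent whenever ($g=g'$ and $hh'\in E(H)$), or ($h=h'$ and $gg'\in E(G)$), or ($gg'\in E(G)$ and $hh'\in E(H)$). -}

module Defs where

open import Data.Nat using (ℕ; zero; suc; _+_; _*_; _≤_)
open import Data.Fin using (Fin; toℕ)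
open import Data.Product using (_×_; Σ; ∃; _,_)
open import Data.Sum using (_⊎_)
open import Data.List using (List; []; _∷_; length)
open import Data.List.Membership.Propositional using (_∈_)
open import Data.List.Relation.Unary.Unique.Propositional using (Unique)
open import Relation.Binary.PropositionalEquality using (_≡_)

record Graph : Set₁ where
  field
    V   : Set
    Adj : V → V → Set
open Graph public

P : ℕ → Graph
V (P m) = Fin m
Adj (P m) i j = (suc (toℕ i) ≡ toℕ j) ⊎ (suc (toℕ j) ≡ toℕ i)

C : ℕ → Graph
V (C n) = Fin n
Adj (C n) i j = CAdj i j ⊎ CAdj j i
  where
  CAdj : Fin n → Fin n → Set
  CAdj a b = (suc (toℕ a) ≡ toℕ b) ⊎ ((suc (toℕ a) ≡ n) × (toℕ b ≡ 0))

_⊠_ : Graph → Graph → Graph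
V (G ⊠ H) = V G × V H
Adj (G ⊠ H) (g , h) (g' , h') =
    ((g ≡ g') × Adj H h h')
  ⊎ ((h ≡ h') × Adj G g g')
  ⊎ (Adj G g g' × Adj H h h')

module _ (G : Graph) where

  data Walk : V G → V G → ℕ → Set where
    [] : ∀ {u} → Walk u u 0
    _∷_ : ∀ {u w v n} → Adj G u w → Walk w v n → Walk u v (suc n)

  verts : ∀ {u v n} → Walk u v n → List (V G)
  verts {u} [] = u ∷ []
  verts {u} (_ ∷ p) = u ∷ verts p

  IsDist : V G → V G → ℕ → Set
  IsDist u v n = Walk u v n × (∀ k → Walk u v k → n ≤ k)

  InInterval : V G → V G → V G → Set
  InInterval u v w = Σ ℕ λ n → IsDist u v n × Σ (Walk u v n) λ p → w ∈ verts p

  Geodetic : List (V G) → Set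
  Geodetic S = ∀ w → Σ (V G) λ u → Σ (V G) λ v → u ∈ S × v ∈ S × InInterval u v w

  GeodeticNumberBetween : ℕ → ℕ → Set
  GeodeticNumberBetween a b =
      (∀ (S : List (V G)) → Unique S → Geodetic S → a ≤ length S)
    × (Σ (List (V G)) λ S → Unique S × Geodetic S × length S ≤ b)

-- Write N = 2k+1, M = m-1 and represent vertices as pairs (row, column) with row ≤ M and
-- column < N. The proof rests on an explicit distance formula: with fw x y the forward
-- distance x → y around the cycle and dc x y = min(fw x y, fw y x), the graph distance is
-- D = max(|row difference|, dc of the columns), so w ∈ I[u,v] iff D u w + D w v = D u v.
--
-- Upper bound: {0, M} × {0, 1, k+1} is geodetic, because every column lies between 1 and k+1
-- or between k+1 and 0, and a vertex of such a column is on a geodesic between two boundary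
-- vertices of those columns. Lower bound: a vertex on row 0 or M is in S or its column is
-- strictly inside a short arc between members of S. Measuring positions forward from a
-- member s₀, the least positive position L ≤ k and the greatest H ≥ k+1 each come with a
-- second member of S in the same half [1, k] resp. [k+1, N): the other boundary vertex of
-- the same column, or the end of a short arc covering that column. With s₀ these are five
-- distinct members. All general lemmas only need m ≥ 2 and k ≥ 1.
module Submission where

open import Defs
open import Data.Nat
open import Data.Nat.Properties
open import Data.Nat.Tactic.RingSolver using (solve-∀)
import Data.Fin as Fin
open Fin using (Fin; toℕ; fromℕ<; fromℕ; inject₁)
open import Data.Fin.Properties using (toℕ<n; toℕ-fromℕ<; toℕ-fromℕ; toℕ-injective; toℕ-inject₁)
open import Data.Product using (Σ; _×_; _,_; proj₁; proj₂)
open import Data.Sum using (_⊎_; inj₁; inj₂)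
open import Data.Empty using (⊥-elim)
open import Data.List using (List; []; _∷_; length)
open import Data.List.Membership.Propositional using (_∈_)
open import Data.List.Relation.Unary.Any using (here; there)
open import Data.List.Relation.Unary.All using (All; []; _∷_)
open import Data.List.Relation.Unary.AllPairs using (AllPairs; []; _∷_)
open import Relation.Nullary using (¬_; Dec; yes; no)
open import Relation.Binary.PropositionalEquality

-- Forward distance on ℤ_N, represented by the numbers 0,…,N-1.
module Forward (N : ℕ) where

  fw : ℕ → ℕ → ℕ
  fw x y with x ≤? y
  ... | yes _ = y ∸ x
  ... | no _ = (N ∸ x) + y

  fw-spec : ∀ {x y} → x < N → (x ≤ y × fw x y + x ≡ y) ⊎ (y < x × fw x y + x ≡ y + N)
  fw-spec {x} {y} x<N with x ≤? y
  ... | yes x≤y = inj₁ (x≤y , m∸n+n≡m x≤y)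
  ... | no x≰y = inj₂ (≰⇒> x≰y , (begin
      N ∸ x + y + x   ≡⟨ +-assoc (N ∸ x) y x ⟩
      N ∸ x + (y + x) ≡⟨ cong (N ∸ x +_) (+-comm y x) ⟩
      N ∸ x + (x + y) ≡⟨ sym (+-assoc (N ∸ x) x y) ⟩
      N ∸ x + x + y   ≡⟨ cong (_+ y) (m∸n+n≡m (<⇒≤ x<N)) ⟩
      N + y           ≡⟨ +-comm N y ⟩
      y + N           ∎))
    where open ≡-Reasoning

  fw-le : ∀ {x y} → x < N → x ≤ y → fw x y ≡ y ∸ x
  fw-le {x} {y} x<N x≤y with fw-spec {x} {y} x<N
  ... | inj₁ (_ , eq) = trans (sym (m+n∸n≡m (fw x y) x)) (cong (_∸ x) eq)
  ... | inj₂ (y<x , _) = ⊥-elim (<⇒≱ y<x x≤y)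

  fw-gt : ∀ {x y} → x < N → y < x → fw x y ≡ (y + N) ∸ x
  fw-gt {x} {y} x<N y<x with fw-spec {x} {y} x<N
  ... | inj₁ (x≤y , _) = ⊥-elim (<⇒≱ y<x x≤y)
  ... | inj₂ (_ , eq) = trans (sym (m+n∸n≡m (fw x y) x)) (cong (_∸ x) eq)

  fw-bound : ∀ {x y} → x < N → y < N → fw x y < N
  fw-bound {x} {y} x<N y<N with x ≤? y
  ... | yes _ = ≤-<-trans (m∸n≤m y x) y<N
  ... | no x≰y = subst (N ∸ x + y <_) (m∸n+n≡m (<⇒≤ x<N)) (+-monoʳ-< (N ∸ x) (≰⇒> x≰y))

  fw-self : ∀ x → fw x x ≡ 0
  fw-self x with x ≤? x
  ... | yes _ = n∸n≡0 x
  ... | no x≰x = ⊥-elim (x≰x ≤-refl)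

  fw≡0⇒≡ : ∀ {x y} → x < N → fw x y ≡ 0 → x ≡ y
  fw≡0⇒≡ {x} {y} x<N e with fw-spec {x} {y} x<N
  ... | inj₁ (_ , eq) = trans (sym (cong (_+ x) e)) eq
  ... | inj₂ (_ , eq) = ⊥-elim (<⇒≱ x<N (subst (N ≤_) (trans (sym eq) (cong (_+ x) e)) (m≤n+m N y)))

  Carry : ℕ → ℕ → Set
  Carry s t = (s ≡ t) ⊎ (s ≡ t + N)

  IsWrap : ℕ → Set
  IsWrap e = (e ≡ 0) ⊎ (e ≡ N)

  fw-wrap : ∀ {x y} → x < N → Σ ℕ λ e → IsWrap e × (fw x y + x ≡ y + e)
  fw-wrap {x} {y} x<N with fw-spec {x} {y} x<N
  ... | inj₁ (_ , eq) = 0 , inj₁ refl , trans eq (sym (+-identityʳ y))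
  ... | inj₂ (_ , eq) = N , inj₂ refl , eq

  -- Adding the three wrap equations for a → b → c and a → c eliminates a, b, c.
  wrap-balance : ∀ {f₁ f₂ f₃ a b c e₁ e₂ e₃} →
    f₁ + a ≡ b + e₁ → f₂ + b ≡ c + e₂ → f₃ + a ≡ c + e₃ → f₁ + f₂ + e₃ ≡ f₃ + e₁ + e₂
  wrap-balance {f₁} {f₂} {f₃} {a} {b} {c} {e₁} {e₂} {e₃} p q r =
    +-cancelʳ-≡ (a + b + c) _ _ (begin
      f₁ + f₂ + e₃ + (a + b + c)       ≡⟨ regroup₁ f₁ f₂ e₃ a b c ⟩
      (f₁ + a) + (f₂ + b) + (c + e₃)   ≡⟨ cong₂ _+_ (cong₂ _+_ p q) (sym r) ⟩
      (b + e₁) + (c + e₂) + (f₃ + a)   ≡⟨ regroup₂ b e₁ c e₂ f₃ a ⟩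
      f₃ + e₁ + e₂ + (a + b + c)       ∎)
    where
    open ≡-Reasoning
    regroup₁ : ∀ f₁ f₂ e₃ a b c → f₁ + f₂ + e₃ + (a + b + c) ≡ (f₁ + a) + (f₂ + b) + (c + e₃)
    regroup₁ = solve-∀
    regroup₂ : ∀ b e₁ c e₂ f₃ a → (b + e₁) + (c + e₂) + (f₃ + a) ≡ f₃ + e₁ + e₂ + (a + b + c)
    regroup₂ = solve-∀

  carry : ∀ {f₁ f₂ f₃ e₁ e₂ e₃} → f₁ < N → f₂ < N → f₃ < N → IsWrap e₁ → IsWrap e₂ → IsWrap e₃ →
          f₁ + f₂ + e₃ ≡ f₃ + e₁ + e₂ → Carry (f₁ + f₂) f₃
  carry _ _ _ (inj₁ refl) (inj₁ refl) (inj₁ refl) eq =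
    inj₁ (trans (sym (+-identityʳ _)) (trans eq (trans (+-identityʳ _) (+-identityʳ _))))
  carry _ _ _ (inj₂ refl) (inj₁ refl) (inj₁ refl) eq =
    inj₂ (trans (sym (+-identityʳ _)) (trans eq (+-identityʳ _)))
  carry _ _ _ (inj₁ refl) (inj₂ refl) (inj₁ refl) eq =
    inj₂ (trans (sym (+-identityʳ _)) (trans eq (cong (_+ N) (+-identityʳ _))))
  carry _ _ _ (inj₂ refl) (inj₁ refl) (inj₂ refl) eq =
    inj₁ (+-cancelʳ-≡ N _ _ (trans eq (+-identityʳ _)))
  carry _ _ _ (inj₁ refl) (inj₂ refl) (inj₂ refl) eq =
    inj₁ (+-cancelʳ-≡ N _ _ (trans eq (cong (_+ N) (+-identityʳ _))))
  carry _ _ _ (inj₂ refl) (inj₂ refl) (inj₂ refl) eq =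
    inj₂ (+-cancelʳ-≡ N _ _ eq)
  carry {f₁} {f₂} {f₃} _ _ f₃<N (inj₁ refl) (inj₁ refl) (inj₂ refl) eq = ⊥-elim (<⇒≱ f₃<N
    (subst (N ≤_) (trans eq (trans (+-identityʳ _) (+-identityʳ _))) (m≤n+m N (f₁ + f₂))))
  carry {f₁} {f₂} {f₃} f₁<N f₂<N _ (inj₂ refl) (inj₂ refl) (inj₁ refl) eq = ⊥-elim (<⇒≱
    (+-mono-< f₁<N f₂<N)
    (subst (N + N ≤_) (trans (sym eq) (+-identityʳ _)) (+-monoˡ-≤ N (m≤n+m N f₃))))

  fw-add : ∀ {a b c} → a < N → b < N → c < N → Carry (fw a b + fw b c) (fw a c)
  fw-add {a} {b} {c} a<N b<N c<N
    with fw-wrap {a} {b} a<N | fw-wrap {b} {c} b<N | fw-wrap {a} {c} a<N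
  ... | e₁ , w₁ , p | e₂ , w₂ , q | e₃ , w₃ , r =
    carry (fw-bound a<N b<N) (fw-bound b<N c<N) (fw-bound a<N c<N) w₁ w₂ w₃
      (wrap-balance {fw a b} {fw b c} {fw a c} {a} {b} {c} {e₁} {e₂} {e₃} p q r)

  fw-opposite : ∀ {x y} → x < N → y < N → x ≢ y → fw x y + fw y x ≡ N
  fw-opposite {x} {y} x<N y<N x≢y with fw-add {x} {y} {x} x<N y<N x<N
  ... | inj₁ eq = ⊥-elim (x≢y (fw≡0⇒≡ x<N (m+n≡0⇒m≡0 _ (trans eq (fw-self x)))))
  ... | inj₂ eq = trans eq (cong (_+ N) (fw-self x))

  carry-comm : ∀ s t {u} → Carry (s + t) u → Carry (t + s) u
  carry-comm s t {u} = subst (λ z → Carry z u) (+-comm s t)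

  carry⇒≤ : ∀ {s t} → Carry s t → t ≤ s
  carry⇒≤ {s} {t} (inj₁ e) = ≤-reflexive (sym e)
  carry⇒≤ {s} {t} (inj₂ e) = subst (t ≤_) (sym e) (m≤m+n t N)

  shorter-route : ∀ {g g' x y} → g < N → g' < N → Carry (g + y) x → Carry (g' + x) y → g ≤ x ⊎ g' ≤ y
  shorter-route {g} {g'} {x} {y} _ _ (inj₁ e) _ = inj₁ (subst (g ≤_) e (m≤m+n g y))
  shorter-route {g} {g'} {x} {y} _ _ (inj₂ _) (inj₁ e) = inj₂ (subst (g' ≤_) e (m≤m+n g' x))
  shorter-route {g} {g'} {x} {y} g<N g'<N (inj₂ e) (inj₂ e') =
    ⊥-elim (<-irrefl (+-cancelʳ-≡ (x + y) _ _ (begin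
      (g + g') + (x + y)     ≡⟨ regroup₁ g g' x y ⟩
      (g + y) + (g' + x)     ≡⟨ cong₂ _+_ e e' ⟩
      (x + N) + (y + N)      ≡⟨ regroup₂ x y N ⟩
      (N + N) + (x + y)      ∎)) (+-mono-< g<N g'<N))
    where
    open ≡-Reasoning
    regroup₁ : ∀ g g' x y → (g + g') + (x + y) ≡ (g + y) + (g' + x)
    regroup₁ = solve-∀
    regroup₂ : ∀ x y n → (x + n) + (y + n) ≡ (n + n) + (x + y)
    regroup₂ = solve-∀

module Cycle (k : ℕ) where

  N : ℕ
  N = suc (2 * k)

  open Forward N public

  N≡ : N ≡ suc (k + k)
  N≡ = cong (λ z → suc (k + z)) (+-identityʳ k)

  complement≤k : ∀ {A B} → A + B ≡ N → suc k ≤ A → B ≤ k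
  complement≤k {A} {B} eq k<A =
    +-cancelˡ-≤ (suc k) B k (≤-trans (+-monoˡ-≤ B k<A) (≤-reflexive (trans eq N≡)))

  complement>k : ∀ {A B} → A + B ≡ N → A ≤ k → suc k ≤ B
  complement>k {A} {B} eq A≤k = +-cancelˡ-≤ k (suc k) B (begin
    k + suc k ≡⟨ trans (+-suc k k) (sym N≡) ⟩
    N         ≡⟨ sym eq ⟩
    A + B     ≤⟨ +-monoˡ-≤ B A≤k ⟩
    k + B     ∎)
    where open ≤-Reasoning

  dc : ℕ → ℕ → ℕ
  dc x y = fw x y ⊓ fw y x

  dc-comm : ∀ x y → dc x y ≡ dc y x
  dc-comm x y = ⊓-comm (fw x y) (fw y x)

  dc-self : ∀ x → dc x x ≡ 0
  dc-self x = cong (λ z → z ⊓ z) (fw-self x)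

  dc-sel : ∀ x y → (dc x y ≡ fw x y) ⊎ (dc x y ≡ fw y x)
  dc-sel x y = ⊓-sel (fw x y) (fw y x)

  dc≤k : ∀ {x y} → x < N → y < N → dc x y ≤ k
  dc≤k {x} {y} x<N y<N with x ≟ y
  ... | yes refl = subst (_≤ k) (sym (dc-self x)) z≤n
  ... | no x≢y with fw x y ≤? k
  ...   | yes short = ≤-trans (m⊓n≤m _ _) short
  ...   | no long = ≤-trans (m⊓n≤n _ _) (complement≤k (fw-opposite x<N y<N x≢y) (≰⇒> long))

  dc≡fw : ∀ {x y} → x < N → y < N → fw x y ≤ k → dc x y ≡ fw x y
  dc≡fw {x} {y} x<N y<N short with x ≟ y
  ... | yes refl = trans (dc-self x) (sym (fw-self x))
  ... | no x≢y = m≤n⇒m⊓n≡m (≤-trans short (≤-trans (n≤1+n k)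
                  (complement>k (fw-opposite x<N y<N x≢y) short)))

  dc≡0⇒≡ : ∀ {x y} → x < N → y < N → dc x y ≡ 0 → x ≡ y
  dc≡0⇒≡ {x} {y} x<N y<N e with dc-sel x y
  ... | inj₁ d = fw≡0⇒≡ x<N (trans (sym d) e)
  ... | inj₂ d = sym (fw≡0⇒≡ y<N (trans (sym d) e))

  converging : ∀ {a b c} → a < N → b < N → c < N → dc a b ≤ fw a c ⊎ dc a b ≤ fw b c
  converging a<N b<N c<N
    with shorter-route (fw-bound a<N b<N) (fw-bound b<N a<N) (fw-add a<N b<N c<N) (fw-add b<N a<N c<N)
  ... | inj₁ le = inj₁ (≤-trans (m⊓n≤m _ _) le)
  ... | inj₂ le = inj₂ (≤-trans (m⊓n≤n _ _) le)

  diverging : ∀ {a b c} → a < N → b < N → c < N → dc a b ≤ fw c a ⊎ dc a b ≤ fw c b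
  diverging {a} {b} {c} a<N b<N c<N
    with shorter-route (fw-bound a<N b<N) (fw-bound b<N a<N)
           (carry-comm (fw c a) (fw a b) (fw-add c<N a<N b<N))
           (carry-comm (fw c b) (fw b a) (fw-add c<N b<N a<N))
  ... | inj₁ le = inj₂ (≤-trans (m⊓n≤m _ _) le)
  ... | inj₂ le = inj₁ (≤-trans (m⊓n≤n _ _) le)

  either≤sum : ∀ {d x y} → d ≤ x ⊎ d ≤ y → d ≤ x + y
  either≤sum {d} {x} {y} (inj₁ le) = ≤-trans le (m≤m+n x y)
  either≤sum {d} {x} {y} (inj₂ le) = ≤-trans le (m≤n+m y x)

  dc-triangle : ∀ {a b c} → a < N → b < N → c < N → dc a b ≤ dc a c + dc c b
  dc-triangle {a} {b} {c} a<N b<N c<N with dc-sel a c | dc-sel c b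
  ... | inj₁ ac | inj₁ cb = ≤-trans (m⊓n≤m _ _)
        (subst (fw a b ≤_) (sym (cong₂ _+_ ac cb)) (carry⇒≤ (fw-add a<N c<N b<N)))
  ... | inj₂ ca | inj₂ cb = ≤-trans (m⊓n≤n _ _)
        (subst (fw b a ≤_) (trans (+-comm (fw b c) (fw c a)) (sym (cong₂ _+_ ca cb))) (carry⇒≤ (fw-add b<N c<N a<N)))
  ... | inj₁ ac | inj₂ cb = subst (dc a b ≤_) (sym (cong₂ _+_ ac cb)) (either≤sum (converging a<N b<N c<N))
  ... | inj₂ ca | inj₁ cb = subst (dc a b ≤_) (sym (cong₂ _+_ ca cb)) (either≤sum (diverging a<N b<N c<N))

  ShortArc : ℕ → ℕ → ℕ → Set
  ShortArc a c b = (1 ≤ fw a c) × (1 ≤ fw c b) × (fw a c + fw c b ≤ k)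

  -- A point strictly between a and b on the cycle lies inside a short forward arc,
  -- from a to b or from b to a: legs in opposite directions would be a detour.
  between⇒short-arc : ∀ {a b c} → a < N → b < N → c < N → 1 ≤ dc a c → 1 ≤ dc c b →
                      dc a c + dc c b ≡ dc a b → ShortArc a c b ⊎ ShortArc b c a
  between⇒short-arc {a} {b} {c} a<N b<N c<N ac≥1 cb≥1 eq = by-orientation (dc-sel a c) (dc-sel c b)
    where
    arc≤k : ∀ {s} → dc a c + dc c b ≡ s → s ≤ k
    arc≤k e = subst (_≤ k) (trans (sym eq) e) (dc≤k a<N b<N)
    detour : ¬ (dc a b ≤ dc a c ⊎ dc a b ≤ dc c b)
    detour (inj₁ le) = <-irrefl refl (<-≤-trans (subst (dc a c <_) eq (m<m+n (dc a c) cb≥1)) le)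
    detour (inj₂ le) = <-irrefl refl (<-≤-trans (subst (dc c b <_) eq (m<n+m (dc c b) ac≥1)) le)
    by-orientation : (dc a c ≡ fw a c) ⊎ (dc a c ≡ fw c a) → (dc c b ≡ fw c b) ⊎ (dc c b ≡ fw b c) →
                     ShortArc a c b ⊎ ShortArc b c a
    by-orientation (inj₁ ac) (inj₁ cb) =
      inj₁ (subst (1 ≤_) ac ac≥1 , subst (1 ≤_) cb cb≥1 , arc≤k (cong₂ _+_ ac cb))
    by-orientation (inj₂ ca) (inj₂ bc) =
      inj₂ (subst (1 ≤_) bc cb≥1 , subst (1 ≤_) ca ac≥1 , arc≤k (trans (cong₂ _+_ ca bc) (+-comm (fw c a) (fw b c))))
    by-orientation (inj₁ ac) (inj₂ bc) = ⊥-elim (detour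
      (subst₂ (λ x y → dc a b ≤ x ⊎ dc a b ≤ y) (sym ac) (sym bc) (converging a<N b<N c<N)))
    by-orientation (inj₂ ca) (inj₁ cb) = ⊥-elim (detour
      (subst₂ (λ x y → dc a b ≤ x ⊎ dc a b ≤ y) (sym ca) (sym cb) (diverging a<N b<N c<N)))

  on-arc : ∀ {a b c} → a < N → b < N → c < N → fw a c ≤ fw a b → fw a c + fw c b ≡ fw a b
  on-arc {a} {b} {c} a<N b<N c<N le with fw-add a<N c<N b<N
  ... | inj₁ e = e
  ... | inj₂ e = ⊥-elim (<⇒≱ (fw-bound c<N b<N) (+-cancelˡ-≤ (fw a b) N (fw c b)
                  (≤-trans (≤-reflexive (sym e)) (+-monoˡ-≤ (fw c b) le))))

  on-short-arc : ∀ {a b c} → a < N → b < N → c < N → fw a c ≤ fw a b → fw a b ≤ k →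
                 dc a c + dc c b ≡ dc a b
  on-short-arc {a} {b} {c} a<N b<N c<N le short = begin
    dc a c + dc c b ≡⟨ cong₂ _+_ (dc≡fw a<N c<N (≤-trans le short)) (dc≡fw c<N b<N cb≤k) ⟩
    fw a c + fw c b ≡⟨ split ⟩
    fw a b          ≡⟨ sym (dc≡fw a<N b<N short) ⟩
    dc a b          ∎
    where
    open ≡-Reasoning
    split : fw a c + fw c b ≡ fw a b
    split = on-arc a<N b<N c<N le
    cb≤k : fw c b ≤ k
    cb≤k = ≤-trans (subst (fw c b ≤_) split (m≤n+m (fw c b) (fw a c))) short

  Succ : ℕ → ℕ → Set
  Succ a b = (suc a ≡ b) ⊎ ((suc a ≡ N) × (b ≡ 0))

  succ⇒fw≡1 : 1 ≤ k → ∀ {a b} → a < N → Succ a b → fw a b ≡ 1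
  succ⇒fw≡1 k≥1 {a} {b} a<N (inj₁ e) with fw-spec {a} {b} a<N
  ... | inj₁ (_ , eq) = +-cancelʳ-≡ a _ _ (trans eq (sym e))
  ... | inj₂ (b<a , _) = ⊥-elim (<-asym b<a (subst (a <_) e ≤-refl))
  succ⇒fw≡1 k≥1 {a} {b} a<N (inj₂ (e , refl)) with fw-spec {a} {b} a<N
  ... | inj₁ (z≤n , _) = ⊥-elim (<-irrefl refl
          (subst (1 ≤_) (sym (cong pred e)) (≤-trans k≥1 (m≤m+n k _))))
  ... | inj₂ (_ , eq) = +-cancelʳ-≡ a _ _ (trans eq (sym e))

  carry-pred : ∀ {f d} → f < N → Carry (suc f) (suc d) → f ≡ d
  carry-pred _ (inj₁ e) = cong pred e
  carry-pred {f} {d} f<N (inj₂ e) = ⊥-elim (<⇒≱ f<N (subst (N ≤_) (sym (cong pred e)) (m≤n+m N d)))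

  fw-step-from : ∀ {a a' z d} → a < N → a' < N → z < N → fw a a' ≡ 1 → fw a z ≡ suc d → fw a' z ≡ d
  fw-step-from {a} {a'} {z} a<N a'<N z<N step e =
    carry-pred (fw-bound a'<N z<N) (subst₂ Carry (cong (_+ fw a' z) step) e (fw-add a<N a'<N z<N))

  fw-step-to : ∀ {a a' z d} → a < N → a' < N → z < N → fw a' a ≡ 1 → fw z a ≡ suc d → fw z a' ≡ d
  fw-step-to {a} {a'} {z} a<N a'<N z<N step e =
    carry-pred (fw-bound z<N a'<N)
      (subst₂ Carry (trans (cong (fw z a' +_) step) (+-comm _ 1)) e (fw-add z<N a'<N a<N))

  descend : ∀ {a a' z d} → a < N → a' < N → z < N → dc a a' ≤ 1 → dc a z ≡ suc d →
            (fw a' z ≡ d) ⊎ (fw z a' ≡ d) → dc a' z ≡ d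
  descend {a} {a'} {z} {d} a<N a'<N z<N edge e short = ≤-antisym (upper short) lower
    where
    upper : (fw a' z ≡ d) ⊎ (fw z a' ≡ d) → dc a' z ≤ d
    upper (inj₁ f) = subst (dc a' z ≤_) f (m⊓n≤m _ _)
    upper (inj₂ f) = subst (dc a' z ≤_) f (m⊓n≤n _ _)
    lower : d ≤ dc a' z
    lower = ≤-pred (≤-trans (≤-reflexive (sym e))
              (≤-trans (dc-triangle a<N z<N a'<N) (+-monoˡ-≤ (dc a' z) edge)))

-- Distance in the strong product P_{M+1} ⊠ C_N is D = max(path distance, cycle distance):
-- no walk is shorter than D, and D can always be decreased by one step.
module Product (M k : ℕ) (k≥1 : 1 ≤ k) where

  open Cycle k public

  Gr : Graph
  Gr = P (suc M) ⊠ C N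

  Vx : Set
  Vx = Fin (suc M) × Fin N

  row : Vx → ℕ
  row u = toℕ (proj₁ u)

  col : Vx → ℕ
  col u = toℕ (proj₂ u)

  0<N : 0 < N
  0<N = s≤s z≤n

  1<N : 1 < N
  1<N = s≤s (≤-trans k≥1 (m≤m+n k _))

  1+k<N : suc k < N
  1+k<N = s≤s (subst (_≤ 2 * k) (+-comm k 1) (+-monoʳ-≤ k (≤-trans k≥1 (m≤m+n k 0))))

  col<N : ∀ u → col u < N
  col<N u = toℕ<n (proj₂ u)

  dp : Vx → Vx → ℕ
  dp u v = ∣ row u - row v ∣

  dcv : Vx → Vx → ℕ
  dcv u v = dc (col u) (col v)

  D : Vx → Vx → ℕ
  D u v = dp u v ⊔ dcv u v

  D-self : ∀ u → D u u ≡ 0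
  D-self u = cong₂ _⊔_ (∣n-n∣≡0 (row u)) (dc-self (col u))

  D≡0⇒≡ : ∀ u v → D u v ≡ 0 → u ≡ v
  D≡0⇒≡ u v e = cong₂ _,_
    (toℕ-injective (∣m-n∣≡0⇒m≡n (n≤0⇒n≡0 (m⊔n≤o⇒m≤o (dp u v) (dcv u v) (≤-reflexive e)))))
    (toℕ-injective (dc≡0⇒≡ (col<N u) (col<N v) (n≤0⇒n≡0 (m⊔n≤o⇒n≤o (dp u v) (dcv u v) (≤-reflexive e)))))

  ∣n-1+n∣≡1 : ∀ n → ∣ n - suc n ∣ ≡ 1
  ∣n-1+n∣≡1 n = trans (m≤n⇒∣m-n∣≡n∸m (n≤1+n n)) (m+n∸n≡m 1 n)

  path-edge : ∀ {i j : Fin (suc M)} → Adj (P (suc M)) i j → ∣ toℕ i - toℕ j ∣ ≤ 1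
  path-edge {i} {j} (inj₁ e) = ≤-reflexive (subst (λ q → ∣ toℕ i - q ∣ ≡ 1) e (∣n-1+n∣≡1 (toℕ i)))
  path-edge {i} {j} (inj₂ e) = ≤-reflexive (subst (λ q → ∣ q - toℕ j ∣ ≡ 1) e
    (trans (∣-∣-comm (suc (toℕ j)) (toℕ j)) (∣n-1+n∣≡1 (toℕ j))))

  cycle-edge : ∀ {a b : Fin N} → Adj (C N) a b → dc (toℕ a) (toℕ b) ≤ 1
  cycle-edge {a} {b} (inj₁ s) = subst (dc (toℕ a) (toℕ b) ≤_) (succ⇒fw≡1 k≥1 (toℕ<n a) s) (m⊓n≤m _ _)
  cycle-edge {a} {b} (inj₂ s) = subst (dc (toℕ a) (toℕ b) ≤_) (succ⇒fw≡1 k≥1 (toℕ<n b) s) (m⊓n≤n _ _)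

  edge-moves : ∀ {u w} → Adj Gr u w → dp u w ≤ 1 × dcv u w ≤ 1
  edge-moves {i , _} (inj₁ (refl , e)) = subst (_≤ 1) (sym (∣n-n∣≡0 (toℕ i))) z≤n , cycle-edge e
  edge-moves {_ , a} (inj₂ (inj₁ (refl , e))) = path-edge e , subst (_≤ 1) (sym (dc-self (toℕ a))) z≤n
  edge-moves (inj₂ (inj₂ (e₁ , e₂))) = path-edge e₁ , cycle-edge e₂

  D-edge : ∀ {u w} v → Adj Gr u w → D u v ≤ suc (D w v)
  D-edge {u} {w} v e = ⊔-mono-≤
    (≤-trans (∣-∣-triangle (row u) (row w) (row v)) (+-monoˡ-≤ (dp w v) (proj₁ (edge-moves e))))
    (≤-trans (dc-triangle (col<N u) (col<N v) (col<N w)) (+-monoˡ-≤ (dcv w v) (proj₂ (edge-moves e))))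

  D-walk : ∀ {u v n} → Walk Gr u v n → D u v ≤ n
  D-walk {u} [] = ≤-reflexive (D-self u)
  D-walk {v = v} (e ∷ p) = ≤-trans (D-edge v e) (s≤s (D-walk p))

  towards : ∀ {d} i z → ∣ i - z ∣ ≡ suc d →
            (suc i ≤ z × ∣ suc i - z ∣ ≡ d) ⊎ (Σ ℕ λ j → i ≡ suc j × ∣ j - z ∣ ≡ d)
  towards zero zero ()
  towards zero (suc z) refl = inj₁ (s≤s z≤n , refl)
  towards (suc i) zero refl = inj₂ (i , refl , ∣-∣-identityʳ i)
  towards (suc i) (suc z) eq with towards i z eq
  ... | inj₁ (le , e) = inj₁ (s≤s le , e)
  ... | inj₂ (j , refl , e) = inj₂ (suc j , refl , e)

  path-descend : ∀ {d} (i z : Fin (suc M)) → ∣ toℕ i - toℕ z ∣ ≡ suc d →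
                 Σ (Fin (suc M)) λ i' → Adj (P (suc M)) i i' × ∣ toℕ i' - toℕ z ∣ ≡ d
  path-descend i z eq with towards (toℕ i) (toℕ z) eq
  ... | inj₁ (le , e) = fromℕ< lt , inj₁ (sym (toℕ-fromℕ< lt)) ,
                        trans (cong (λ q → ∣ q - toℕ z ∣) (toℕ-fromℕ< lt)) e
    where
    lt : suc (toℕ i) < suc M
    lt = ≤-<-trans le (toℕ<n z)
  ... | inj₂ (j , ij , e) = fromℕ< lt , inj₂ (trans (cong suc (toℕ-fromℕ< lt)) (sym ij)) ,
                            trans (cong (λ q → ∣ q - toℕ z ∣) (toℕ-fromℕ< lt)) e
    where
    lt : j < suc M
    lt = <-trans (subst (j <_) (sym ij) ≤-refl) (toℕ<n i)

  succ-vertex : (a : Fin N) → Σ (Fin N) λ b → Succ (toℕ a) (toℕ b)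
  succ-vertex a with suc (toℕ a) <? N
  ... | yes lt = fromℕ< lt , inj₁ (sym (toℕ-fromℕ< lt))
  ... | no nlt = Fin.zero , inj₂ (≤-antisym (toℕ<n a) (≮⇒≥ nlt) , refl)

  pred-vertex : (a : Fin N) → Σ (Fin N) λ b → Succ (toℕ b) (toℕ a)
  pred-vertex Fin.zero = fromℕ (2 * k) , inj₂ (cong suc (toℕ-fromℕ (2 * k)) , refl)
  pred-vertex (Fin.suc a) = inject₁ a , inj₁ (cong suc (toℕ-inject₁ a))

  cycle-descend : ∀ {d} (a z : Fin N) → dc (toℕ a) (toℕ z) ≡ suc d →
                  Σ (Fin N) λ a' → Adj (C N) a a' × dc (toℕ a') (toℕ z) ≡ d
  cycle-descend a z e with dc-sel (toℕ a) (toℕ z) | succ-vertex a | pred-vertex a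
  ... | inj₁ fwd | b , s | _ = b , inj₁ s ,
        descend (toℕ<n a) (toℕ<n b) (toℕ<n z) (cycle-edge (inj₁ s)) e
          (inj₁ (fw-step-from (toℕ<n a) (toℕ<n b) (toℕ<n z) (succ⇒fw≡1 k≥1 (toℕ<n a) s) (trans (sym fwd) e)))
  ... | inj₂ bwd | _ | b , s = b , inj₂ s ,
        descend (toℕ<n a) (toℕ<n b) (toℕ<n z) (cycle-edge {a} {b} (inj₂ s)) e
          (inj₂ (fw-step-to (toℕ<n a) (toℕ<n b) (toℕ<n z) (succ⇒fw≡1 k≥1 (toℕ<n b) s) (trans (sym bwd) e)))

  -- Decrease every coordinate distance that is positive.
  D-descend : ∀ {d} u v → D u v ≡ suc d → Σ Vx λ w → Adj Gr u w × D w v ≡ d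
  D-descend {d} (i , a) (z , c) eq = by-coordinates _ _ refl refl
    where
    by-coordinates : ∀ p q → ∣ toℕ i - toℕ z ∣ ≡ p → dc (toℕ a) (toℕ c) ≡ q →
                     Σ Vx λ w → Adj Gr (i , a) w × D w (z , c) ≡ d
    by-coordinates zero zero ep eq' = ⊥-elim (1+n≢0 (trans (sym eq) (cong₂ _⊔_ ep eq')))
    by-coordinates zero (suc q) ep eq' with cycle-descend a c eq'
    ... | a' , adj , e = (i , a') , inj₁ (refl , adj) ,
          trans (cong₂ _⊔_ ep e) (cong pred (trans (sym (cong₂ _⊔_ ep eq')) eq))
    by-coordinates (suc p) zero ep eq' with path-descend i z ep
    ... | i' , adj , e = (i' , a) , inj₂ (inj₁ (refl , adj)) ,
          trans (cong₂ _⊔_ e eq') (trans (⊔-identityʳ p) (cong pred (trans (sym (cong₂ _⊔_ ep eq')) eq)))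
    by-coordinates (suc p) (suc q) ep eq' with path-descend i z ep | cycle-descend a c eq'
    ... | i' , adj , e | a' , adj' , e' = (i' , a') , inj₂ (inj₂ (adj , adj')) ,
          trans (cong₂ _⊔_ e e') (cong pred (trans (sym (cong₂ _⊔_ ep eq')) eq))

  shortest-walk : ∀ u v → Walk Gr u v (D u v)
  shortest-walk u v = go (D u v) u v refl
    where
    go : ∀ d u v → D u v ≡ d → Walk Gr u v d
    go zero u v eq with D≡0⇒≡ u v eq
    ... | refl = []
    go (suc d) u v eq with D-descend u v eq
    ... | w , adj , e = adj ∷ go d w v e

  _++W_ : ∀ {u w v n₁ n₂} → Walk Gr u w n₁ → Walk Gr w v n₂ → Walk Gr u v (n₁ + n₂)
  [] ++W q = q
  (e ∷ p) ++W q = e ∷ (p ++W q)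

  ∈-++W : ∀ {u w v n₁ n₂ x} (p : Walk Gr u w n₁) (q : Walk Gr w v n₂) →
          x ∈ verts Gr q → x ∈ verts Gr (p ++W q)
  ∈-++W [] q h = h
  ∈-++W (e ∷ p) q h = there (∈-++W p q h)

  start∈ : ∀ {w v n} (q : Walk Gr w v n) → w ∈ verts Gr q
  start∈ [] = here refl
  start∈ (e ∷ q) = here refl

  split-at : ∀ {u v n x} (p : Walk Gr u v n) → x ∈ verts Gr p →
             Σ ℕ λ n₁ → Σ ℕ λ n₂ → Walk Gr u x n₁ × Walk Gr x v n₂ × n₁ + n₂ ≡ n
  split-at [] (here refl) = 0 , 0 , [] , [] , refl
  split-at (e ∷ p) (here refl) = 0 , _ , [] , e ∷ p , refl
  split-at (e ∷ p) (there h) with split-at p h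
  ... | n₁ , n₂ , p₁ , p₂ , eq = suc n₁ , n₂ , e ∷ p₁ , p₂ , cong suc eq

  D-triangle : ∀ u w v → D u v ≤ D u w + D w v
  D-triangle u w v = D-walk (shortest-walk u w ++W shortest-walk w v)

  interval-intro : ∀ u v w → D u w + D w v ≡ D u v → InInterval Gr u v w
  interval-intro u v w eq = D u w + D w v ,
    (walk , λ j r → subst (_≤ j) (sym eq) (D-walk r)) ,
    walk , ∈-++W (shortest-walk u w) (shortest-walk w v) (start∈ (shortest-walk w v))
    where
    walk : Walk Gr u v (D u w + D w v)
    walk = shortest-walk u w ++W shortest-walk w v

  interval-elim : ∀ u v w → InInterval Gr u v w → D u w + D w v ≡ D u v
  interval-elim u v w (n , (_ , minimal) , p , w∈p) with split-at p w∈p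
  ... | n₁ , n₂ , p₁ , p₂ , eq = ≤-antisym
    (≤-trans (+-mono-≤ (D-walk p₁) (D-walk p₂)) (≤-trans (≤-reflexive eq) (minimal _ (shortest-walk u v))))
    (D-triangle u w v)

module UpperBound (M k : ℕ) (M≥1 : 1 ≤ M) (k≥1 : 1 ≤ k) where

  open Product M k k≥1

  r0 rM : Fin (suc M)
  r0 = Fin.zero
  rM = fromℕ M

  legs-dominate : ∀ {x y t s} → x ≤ t → y ≤ s → (x ⊔ t) + (y ⊔ s) ≡ t + s
  legs-dominate x≤t y≤s = cong₂ _+_ (m≤n⇒m⊔n≡n x≤t) (m≤n⇒m⊔n≡n y≤s)

  rows-dominate : ∀ {x y t s} → t ≤ x → s ≤ y → (x ⊔ t) + (y ⊔ s) ≡ x + y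
  rows-dominate t≤x s≤y = cong₂ _+_ (m≥n⇒m⊔n≡m t≤x) (m≥n⇒m⊔n≡m s≤y)

  BoundaryCover : Fin N → Fin N → Vx → Set
  BoundaryCover a b w =
      InInterval Gr (r0 , a) (r0 , b) w
    ⊎ InInterval Gr (rM , a) (rM , b) w
    ⊎ InInterval Gr (r0 , a) (rM , a) w
    ⊎ InInterval Gr (r0 , b) (rM , b) w

  -- If column c lies between a and b on the cycle then every vertex of column c is covered:
  -- with x, y the distances of its row to rows 0 and M and t, s its cycle legs to a and b,
  -- the smaller leg is either at most both of x, y (use a column pair) or exceeds one of
  -- them, which is then at most both legs (use a row pair).
  boundary-cover : ∀ (a b c : Fin N) (i : Fin (suc M)) →
                   dc (toℕ a) (toℕ c) + dc (toℕ c) (toℕ b) ≡ dc (toℕ a) (toℕ b) → BoundaryCover a b (i , c)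
  boundary-cover a b c i between = choose
    where
    x = toℕ i
    y = M ∸ x
    t = dc (toℕ a) (toℕ c)
    s = dc (toℕ c) (toℕ b)
    x≤M : x ≤ M
    x≤M = ≤-pred (toℕ<n i)
    from-M : ∣ toℕ rM - x ∣ ≡ y
    from-M = trans (cong (λ q → ∣ q - x ∣) (toℕ-fromℕ M)) (m≤n⇒∣n-m∣≡n∸m x≤M)
    to-M : ∣ x - toℕ rM ∣ ≡ y
    to-M = trans (∣-∣-comm x (toℕ rM)) from-M
    M-apart : ∀ d → ∣ 0 - toℕ rM ∣ ⊔ dc d d ≡ x + y
    M-apart d = trans (cong₂ _⊔_ (toℕ-fromℕ M) (dc-self d)) (trans (⊔-identityʳ M) (sym (m+[n∸m]≡n x≤M)))
    via-row0 : x ≤ t → x ≤ s → BoundaryCover a b (i , c)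
    via-row0 p q = inj₁ (interval-intro _ _ _ (begin
      (x ⊔ t) + (∣ x - 0 ∣ ⊔ s) ≡⟨ cong (λ z → (x ⊔ t) + (z ⊔ s)) (∣-∣-identityʳ x) ⟩
      (x ⊔ t) + (x ⊔ s)         ≡⟨ legs-dominate p q ⟩
      t + s                     ≡⟨ between ⟩
      dc (toℕ a) (toℕ b)        ∎))
      where open ≡-Reasoning
    via-rowM : y ≤ t → y ≤ s → BoundaryCover a b (i , c)
    via-rowM p q = inj₂ (inj₁ (interval-intro _ _ _ (begin
      (∣ toℕ rM - x ∣ ⊔ t) + (∣ x - toℕ rM ∣ ⊔ s) ≡⟨ cong₂ (λ z z' → (z ⊔ t) + (z' ⊔ s)) from-M to-M ⟩
      (y ⊔ t) + (y ⊔ s)                         ≡⟨ legs-dominate p q ⟩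
      t + s                                     ≡⟨ between ⟩
      dc (toℕ a) (toℕ b)                        ≡⟨ cong (_⊔ dc (toℕ a) (toℕ b)) (sym (∣n-n∣≡0 (toℕ rM))) ⟩
      ∣ toℕ rM - toℕ rM ∣ ⊔ dc (toℕ a) (toℕ b)  ∎)))
      where open ≡-Reasoning
    via-column-a : t ≤ x → t ≤ y → BoundaryCover a b (i , c)
    via-column-a p q = inj₂ (inj₂ (inj₁ (interval-intro _ _ _ (begin
      (x ⊔ t) + (∣ x - toℕ rM ∣ ⊔ dc (toℕ c) (toℕ a)) ≡⟨ cong₂ (λ z z' → (x ⊔ t) + (z ⊔ z')) to-M (dc-comm (toℕ c) (toℕ a)) ⟩
      (x ⊔ t) + (y ⊔ t)                             ≡⟨ rows-dominate p q ⟩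
      x + y                                         ≡⟨ sym (M-apart (toℕ a)) ⟩
      ∣ 0 - toℕ rM ∣ ⊔ dc (toℕ a) (toℕ a)           ∎))))
      where open ≡-Reasoning
    via-column-b : s ≤ x → s ≤ y → BoundaryCover a b (i , c)
    via-column-b p q = inj₂ (inj₂ (inj₂ (interval-intro _ _ _ (begin
      (x ⊔ dc (toℕ b) (toℕ c)) + (∣ x - toℕ rM ∣ ⊔ s) ≡⟨ cong₂ (λ z z' → (x ⊔ z) + (z' ⊔ s)) (dc-comm (toℕ b) (toℕ c)) to-M ⟩
      (x ⊔ s) + (y ⊔ s)                             ≡⟨ rows-dominate p q ⟩
      x + y                                         ≡⟨ sym (M-apart (toℕ b)) ⟩
      ∣ 0 - toℕ rM ∣ ⊔ dc (toℕ b) (toℕ b)           ∎))))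
      where open ≡-Reasoning
    choose : BoundaryCover a b (i , c)
    choose with t ≤? s
    choose | yes t≤s with t ≤? x | t ≤? y
    ... | yes p | yes q = via-column-a p q
    ... | no p | _ = via-row0 (<⇒≤ (≰⇒> p)) (≤-trans (<⇒≤ (≰⇒> p)) t≤s)
    ... | yes _ | no q = via-rowM (<⇒≤ (≰⇒> q)) (≤-trans (<⇒≤ (≰⇒> q)) t≤s)
    choose | no t≰s with s ≤? x | s ≤? y
    ... | yes p | yes q = via-column-b p q
    ... | no p | _ = via-row0 (≤-trans (<⇒≤ (≰⇒> p)) (<⇒≤ (≰⇒> t≰s))) (<⇒≤ (≰⇒> p))
    ... | yes _ | no q = via-rowM (≤-trans (<⇒≤ (≰⇒> q)) (<⇒≤ (≰⇒> t≰s))) (<⇒≤ (≰⇒> q))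

  fw-1-[1+k] : fw 1 (suc k) ≡ k
  fw-1-[1+k] = fw-le 1<N (s≤s z≤n)

  fw-[1+k]-0 : fw (suc k) 0 ≡ k
  fw-[1+k]-0 = trans (fw-gt 1+k<N (s≤s z≤n)) (trans (m+n∸m≡n k (k + 0)) (+-identityʳ k))

  two-arcs-cover : ∀ {c} → c < N → fw 1 c ≤ k ⊎ fw (suc k) c ≤ k
  two-arcs-cover {c} c<N with subst (λ z → Carry (z + fw (suc k) c) (fw 1 c)) fw-1-[1+k] (fw-add 1<N 1+k<N c<N)
  ... | inj₁ e = inj₂ (+-cancelˡ-≤ k (fw (suc k) c) k
        (≤-pred (≤-trans (subst (_< N) (sym e) (fw-bound 1<N c<N)) (≤-reflexive N≡))))
  ... | inj₂ e = inj₁ (+-cancelʳ-≤ N (fw 1 c) k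
        (≤-trans (≤-reflexive (sym e)) (+-monoʳ-≤ k (<⇒≤ (fw-bound 1+k<N c<N)))))

  c0 c1 cK : Fin N
  c0 = Fin.zero
  c1 = fromℕ< 1<N
  cK = fromℕ< 1+k<N

  c1≡ : toℕ c1 ≡ 1
  c1≡ = toℕ-fromℕ< 1<N

  cK≡ : toℕ cK ≡ suc k
  cK≡ = toℕ-fromℕ< 1+k<N

  Between : Fin N → Fin N → Fin N → Set
  Between a c b = dc (toℕ a) (toℕ c) + dc (toℕ c) (toℕ b) ≡ dc (toℕ a) (toℕ b)

  column-between : ∀ (c : Fin N) → Between c1 c cK ⊎ Between cK c c0
  column-between c with two-arcs-cover (toℕ<n c)
  ... | inj₁ le = inj₁ (subst₂ (λ p q → dc p (toℕ c) + dc (toℕ c) q ≡ dc p q) (sym c1≡) (sym cK≡)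
        (on-short-arc 1<N 1+k<N (toℕ<n c) (subst (fw 1 (toℕ c) ≤_) (sym fw-1-[1+k]) le) (≤-reflexive fw-1-[1+k])))
  ... | inj₂ le = inj₂ (subst (λ p → dc p (toℕ c) + dc (toℕ c) 0 ≡ dc p 0) (sym cK≡)
        (on-short-arc 1+k<N 0<N (toℕ<n c) (subst (fw (suc k) (toℕ c) ≤_) (sym fw-[1+k]-0) le) (≤-reflexive fw-[1+k]-0)))

  S6 : List Vx
  S6 = (r0 , c0) ∷ (r0 , c1) ∷ (r0 , cK) ∷ (rM , c0) ∷ (rM , c1) ∷ (rM , cK) ∷ []

  covered-by-S6 : ∀ {a b w} → (r0 , a) ∈ S6 → (r0 , b) ∈ S6 → (rM , a) ∈ S6 → (rM , b) ∈ S6 →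
                  BoundaryCover a b w → Σ Vx λ u → Σ Vx λ v → u ∈ S6 × v ∈ S6 × InInterval Gr u v w
  covered-by-S6 p q r s (inj₁ I) = _ , _ , p , q , I
  covered-by-S6 p q r s (inj₂ (inj₁ I)) = _ , _ , r , s , I
  covered-by-S6 p q r s (inj₂ (inj₂ (inj₁ I))) = _ , _ , p , r , I
  covered-by-S6 p q r s (inj₂ (inj₂ (inj₂ I))) = _ , _ , q , s , I

  S6-geodetic : Geodetic Gr S6
  S6-geodetic (i , c) with column-between c
  ... | inj₁ e = covered-by-S6 (there (here refl)) (there (there (here refl)))
                   (there (there (there (there (here refl))))) (there (there (there (there (there (here refl))))))
                   (boundary-cover c1 cK c i e)
  ... | inj₂ e = covered-by-S6 (there (there (here refl))) (here refl)
                   (there (there (there (there (there (here refl)))))) (there (there (there (here refl))))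
                   (boundary-cover cK c0 c i e)

  col-≢ : ∀ {r r' : Fin (suc M)} {c c' : Fin N} → toℕ c ≢ toℕ c' → (r , c) ≢ (r' , c')
  col-≢ h refl = h refl

  row-≢ : ∀ {r r' : Fin (suc M)} {c c' : Fin N} → toℕ r ≢ toℕ r' → (r , c) ≢ (r' , c')
  row-≢ h refl = h refl

  c0≢c1 : toℕ c0 ≢ toℕ c1
  c0≢c1 e = 0≢1+n (trans e c1≡)

  c0≢cK : toℕ c0 ≢ toℕ cK
  c0≢cK e = 0≢1+n (trans e cK≡)

  c1≢cK : toℕ c1 ≢ toℕ cK
  c1≢cK e = <-irrefl refl (subst (1 ≤_) (sym (cong pred (trans (sym c1≡) (trans e cK≡)))) k≥1)

  r0≢rM : toℕ r0 ≢ toℕ rM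
  r0≢rM e = <-irrefl refl (subst (1 ≤_) (trans (sym (toℕ-fromℕ M)) (sym e)) M≥1)

  S6-unique : AllPairs _≢_ S6
  S6-unique =
    (col-≢ c0≢c1 ∷ col-≢ c0≢cK ∷ row-≢ r0≢rM ∷ row-≢ r0≢rM ∷ row-≢ r0≢rM ∷ []) ∷
    (col-≢ c1≢cK ∷ row-≢ r0≢rM ∷ row-≢ r0≢rM ∷ row-≢ r0≢rM ∷ []) ∷
    (row-≢ r0≢rM ∷ row-≢ r0≢rM ∷ row-≢ r0≢rM ∷ []) ∷
    (col-≢ c0≢c1 ∷ col-≢ c0≢cK ∷ []) ∷
    (col-≢ c1≢cK ∷ []) ∷ [] ∷ []

module _ {A : Set} where

  remove : ∀ {x : A} {xs} → x ∈ xs →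
           Σ (List A) λ ys → length xs ≡ suc (length ys) × (∀ {y} → y ∈ xs → y ≢ x → y ∈ ys)
  remove {xs = _ ∷ xs} (here refl) = xs , refl , λ { (here refl) ne → ⊥-elim (ne refl) ; (there m) _ → m }
  remove {xs = z ∷ xs} (there m) with remove m
  ... | ys , eq , keep = z ∷ ys , cong suc eq , λ { (here refl) _ → here refl ; (there m') ne → there (keep m' ne) }

  distinct-length : ∀ (ds xs : List A) → AllPairs _≢_ ds → All (_∈ xs) ds → length ds ≤ length xs
  distinct-length [] xs _ _ = z≤n
  distinct-length (d ∷ ds) xs (d≢ds ∷ distinct) (d∈xs ∷ ds∈xs) with remove d∈xs
  ... | ys , eq , keep = subst (suc (length ds) ≤_) (sym eq) (s≤s (distinct-length ds ys distinct (still d≢ds ds∈xs)))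
    where
    still : ∀ {es} → All (d ≢_) es → All (_∈ xs) es → All (_∈ ys) es
    still [] [] = []
    still (ne ∷ nes) (m ∷ ms) = keep m (λ q → ne (sym q)) ∷ still nes ms

  least-such : (f : A → ℕ) (P : A → Set) (P? : ∀ x → Dec (P x)) (xs : List A) →
               (∀ {z} → z ∈ xs → ¬ P z) ⊎ (Σ A λ y → y ∈ xs × P y × (∀ {z} → z ∈ xs → P z → f y ≤ f z))
  least-such f P P? [] = inj₁ (λ ())
  least-such f P P? (x ∷ xs) with P? x | least-such f P P? xs
  ... | no ¬px | inj₁ none = inj₁ λ { (here refl) → ¬px ; (there m) → none m }
  ... | no ¬px | inj₂ (y , m , py , least) =
        inj₂ (y , there m , py , λ { (here refl) pz → ⊥-elim (¬px pz) ; (there m') pz → least m' pz })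
  ... | yes px | inj₁ none =
        inj₂ (x , here refl , px , λ { (here refl) _ → ≤-refl ; (there m') pz → ⊥-elim (none m' pz) })
  ... | yes px | inj₂ (y , m , py , least) with f x ≤? f y
  ...   | yes le = inj₂ (x , here refl , px , λ { (here refl) _ → ≤-refl ; (there m') pz → ≤-trans le (least m' pz) })
  ...   | no nle = inj₂ (y , there m , py , λ { (here refl) _ → <⇒≤ (≰⇒> nle) ; (there m') pz → least m' pz })

  greatest : (f : A → ℕ) (xs : List A) → ∀ {x} → x ∈ xs → Σ A λ y → y ∈ xs × (∀ {z} → z ∈ xs → f z ≤ f y)
  greatest f (x ∷ []) (here refl) = x , here refl , λ { (here refl) → ≤-refl ; (there ()) }
  greatest f (x ∷ []) (there ())
  greatest f (x ∷ y ∷ xs) _ with greatest f (y ∷ xs) (here refl)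
  ... | m , m∈ , top with f x ≤? f m
  ...   | yes le = m , there m∈ , λ { (here refl) → le ; (there z) → top z }
  ...   | no nle = x , here refl , λ { (here refl) → ≤-refl ; (there z) → ≤-trans (top z) (<⇒≤ (≰⇒> nle)) }

x+n≤n⇒x≡0 : ∀ {x n} → x + n ≤ n → x ≡ 0
x+n≤n⇒x≡0 {zero} _ = refl
x+n≤n⇒x≡0 {suc x} {n} le = ⊥-elim (<-irrefl refl (≤-trans (s≤s (m≤n+m n x)) le))

sum≤max⇒zero : ∀ {x y} → x + y ≤ x ⊔ y → x ≡ 0 ⊎ y ≡ 0
sum≤max⇒zero {x} {y} le with x ≤? y
... | yes p = inj₁ (x+n≤n⇒x≡0 (≤-trans le (≤-reflexive (m≤n⇒m⊔n≡n p))))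
... | no p = inj₂ (x+n≤n⇒x≡0 (subst (_≤ x) (+-comm x y) (≤-trans le (≤-reflexive (m≥n⇒m⊔n≡m (<⇒≤ (≰⇒> p)))))))

dominated-split : ∀ x y d₁ d₂ d₃ → x ≤ d₁ → y ≤ d₂ → d₁ + d₂ ≡ d₃ →
                  (x ≡ 0 × d₁ ≡ 0) ⊎ (y ≡ 0 × d₂ ≡ 0) ⊎ (1 ≤ d₁ × 1 ≤ d₂ × d₁ + d₂ ≡ d₃)
dominated-split x y zero d₂ d₃ z≤n _ _ = inj₁ (refl , refl)
dominated-split x y (suc _) zero d₃ _ z≤n _ = inj₂ (inj₁ (refl , refl))
dominated-split x y (suc _) (suc _) d₃ _ _ legs = inj₂ (inj₂ (s≤s z≤n , s≤s z≤n , legs))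

-- Let w be a vertex with row offsets x, y and cycle
-- distances d₁, d₂ to u, v, where u, v are z rows and d₃ cycle steps apart. If the row part
-- cannot gain by passing through w (z ≤ x ⊔ y) and w lies on a geodesic, then w is u, or w
-- is v, or w lies strictly between u and v on the cycle.
geodesic-split : ∀ x y z d₁ d₂ d₃ → z ≤ x ⊔ y → d₃ ≤ d₁ + d₂ → (x ⊔ d₁) + (y ⊔ d₂) ≡ z ⊔ d₃ →
                 (x ≡ 0 × d₁ ≡ 0) ⊎ (y ≡ 0 × d₂ ≡ 0) ⊎ (1 ≤ d₁ × 1 ≤ d₂ × d₁ + d₂ ≡ d₃)
geodesic-split x y z d₁ d₂ d₃ z≤x⊔y tri eq with ≤-total z d₃
... | inj₁ z≤d₃ = dominated-split x y d₁ d₂ d₃ x≤d₁ y≤d₂ legs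
  where
  total : (x ⊔ d₁) + (y ⊔ d₂) ≡ d₃
  total = trans eq (m≤n⇒m⊔n≡n z≤d₃)
  legs : d₁ + d₂ ≡ d₃
  legs = ≤-antisym (≤-trans (+-mono-≤ (m≤n⊔m x d₁) (m≤n⊔m y d₂)) (≤-reflexive total)) tri
  x≤d₁ : x ≤ d₁
  x≤d₁ = ≤-trans (m≤m⊔n x d₁) (+-cancelʳ-≤ d₂ (x ⊔ d₁) d₁
           (≤-trans (+-monoʳ-≤ (x ⊔ d₁) (m≤n⊔m y d₂)) (≤-reflexive (trans total (sym legs)))))
  y≤d₂ : y ≤ d₂
  y≤d₂ = ≤-trans (m≤m⊔n y d₂) (+-cancelˡ-≤ d₁ (y ⊔ d₂) d₂
           (≤-trans (+-monoˡ-≤ (y ⊔ d₂) (m≤n⊔m x d₁)) (≤-reflexive (trans total (sym legs)))))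
... | inj₂ d₃≤z = by-rows (sum≤max⇒zero (≤-trans (+-mono-≤ (m≤m⊔n x d₁) (m≤m⊔n y d₂)) (≤-trans (≤-reflexive total) z≤x⊔y)))
  where
  total : (x ⊔ d₁) + (y ⊔ d₂) ≡ z
  total = trans eq (m≥n⇒m⊔n≡m d₃≤z)
  by-rows : x ≡ 0 ⊎ y ≡ 0 → (x ≡ 0 × d₁ ≡ 0) ⊎ (y ≡ 0 × d₂ ≡ 0) ⊎ (1 ≤ d₁ × 1 ≤ d₂ × d₁ + d₂ ≡ d₃)
  by-rows (inj₁ refl) = inj₁ (refl , x+n≤n⇒x≡0 (≤-trans (≤-reflexive total) (≤-trans z≤x⊔y (m≤m⊔n y d₂))))
  by-rows (inj₂ refl) = inj₂ (inj₁ (refl , x+n≤n⇒x≡0 (subst (_≤ x ⊔ d₁) (+-comm (x ⊔ d₁) d₂)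
    (≤-trans (≤-reflexive total) (≤-trans z≤x⊔y (≤-trans (≤-reflexive (⊔-identityʳ x)) (m≤m⊔n x d₁)))))))

+-swapʳ : ∀ x y z → x + y + z ≡ x + z + y
+-swapʳ = solve-∀

module LowerBound (M k : ℕ) (M≥1 : 1 ≤ M) (k≥1 : 1 ≤ k) where

  open Product M k k≥1

  rM : Fin (suc M)
  rM = fromℕ M

  row≤M : ∀ u → row u ≤ M
  row≤M u = ≤-pred (toℕ<n (proj₁ u))

  ∣a-b∣≤gap : ∀ {a b} → a ≤ M → b ≤ M → ∣ a - b ∣ ≤ (M ∸ a) ⊔ (M ∸ b)
  ∣a-b∣≤gap {a} {b} a≤M b≤M with ≤-total a b
  ... | inj₁ a≤b = ≤-trans (≤-reflexive (m≤n⇒∣m-n∣≡n∸m a≤b)) (≤-trans (∸-monoˡ-≤ a b≤M) (m≤m⊔n (M ∸ a) (M ∸ b)))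
  ... | inj₂ b≤a = ≤-trans (≤-reflexive (m≤n⇒∣n-m∣≡n∸m b≤a)) (≤-trans (∸-monoˡ-≤ b a≤M) (m≤n⊔m (M ∸ a) (M ∸ b)))

  boundary-row : ∀ u v w → (row w ≡ 0 ⊎ row w ≡ M) → dp u v ≤ dp u w ⊔ dp w v
  boundary-row u v w (inj₁ e) = subst (λ r → dp u v ≤ ∣ row u - r ∣ ⊔ ∣ r - row v ∣) (sym e)
    (subst (λ q → dp u v ≤ q ⊔ row v) (sym (∣-∣-identityʳ (row u))) (∣m-n∣≤m⊔n (row u) (row v)))
  boundary-row u v w (inj₂ e) = subst (λ r → dp u v ≤ ∣ row u - r ∣ ⊔ ∣ r - row v ∣) (sym e)
    (subst₂ (λ p q → dp u v ≤ p ⊔ q) (sym (m≤n⇒∣m-n∣≡n∸m (row≤M u))) (sym (m≤n⇒∣n-m∣≡n∸m (row≤M v)))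
      (∣a-b∣≤gap (row≤M u) (row≤M v)))

  boundary-in-interval : ∀ u v w → (row w ≡ 0 ⊎ row w ≡ M) → InInterval Gr u v w →
    w ≡ u ⊎ w ≡ v ⊎ ShortArc (col u) (col w) (col v) ⊎ ShortArc (col v) (col w) (col u)
  boundary-in-interval u v w boundary I
    with geodesic-split (dp u w) (dp w v) (dp u v) (dcv u w) (dcv w v) (dcv u v)
           (boundary-row u v w boundary) (dc-triangle (col<N u) (col<N v) (col<N w)) (interval-elim u v w I)
  ... | inj₁ (x0 , d0) = inj₁ (sym (D≡0⇒≡ u w (cong₂ _⊔_ x0 d0)))
  ... | inj₂ (inj₁ (y0 , d0)) = inj₂ (inj₁ (D≡0⇒≡ w v (cong₂ _⊔_ y0 d0)))
  ... | inj₂ (inj₂ (ac≥1 , cb≥1 , legs)) =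
        inj₂ (inj₂ (between⇒short-arc (col<N u) (col<N v) (col<N w) ac≥1 cb≥1 legs))

  k<N : k < N
  k<N = <-trans (n<1+n k) 1+k<N

  module _ (S : List Vx) (geodetic : Geodetic Gr S) where

    Covered : ℕ → Set
    Covered c = Σ Vx λ u → Σ Vx λ v → u ∈ S × v ∈ S × ShortArc (col u) c (col v)

    boundary-vertex : ∀ (r : Fin (suc M)) (c : Fin N) → (toℕ r ≡ 0 ⊎ toℕ r ≡ M) → (r , c) ∈ S ⊎ Covered (toℕ c)
    boundary-vertex r c boundary with geodetic (r , c)
    ... | u , v , u∈ , v∈ , I with boundary-in-interval u v (r , c) boundary I
    ...   | inj₁ refl = inj₁ u∈
    ...   | inj₂ (inj₁ refl) = inj₁ v∈
    ...   | inj₂ (inj₂ (inj₁ arc)) = inj₂ (u , v , u∈ , v∈ , arc)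
    ...   | inj₂ (inj₂ (inj₂ arc)) = inj₂ (v , u , v∈ , u∈ , arc)

    column-cases : ∀ (c : Fin N) → ((Fin.zero , c) ∈ S × (rM , c) ∈ S) ⊎ Covered (toℕ c)
    column-cases c with boundary-vertex Fin.zero c (inj₁ refl) | boundary-vertex rM c (inj₂ (toℕ-fromℕ M))
    ... | inj₂ cov | _ = inj₂ cov
    ... | inj₁ _ | inj₂ cov = inj₂ cov
    ... | inj₁ m₀ | inj₁ mM = inj₁ (m₀ , mM)

    s₀ : Vx
    s₀ = proj₁ (geodetic (Fin.zero , Fin.zero))

    s₀∈ : s₀ ∈ S
    s₀∈ = proj₁ (proj₂ (proj₂ (geodetic (Fin.zero , Fin.zero))))

    a₀ : ℕ
    a₀ = col s₀

    a₀<N : a₀ < N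
    a₀<N = col<N s₀

    pos : Vx → ℕ
    pos u = fw a₀ (col u)

    pos-s₀ : pos s₀ ≡ 0
    pos-s₀ = fw-self a₀

    pos-≢ : ∀ {x y} → pos x < pos y → x ≢ y
    pos-≢ lt refl = <-irrefl refl lt

    column-at : ∀ q → q < N → Σ (Fin N) λ c → fw a₀ (toℕ c) ≡ q
    column-at q q<N with a₀ + q <? N
    ... | yes lt = fromℕ< lt , trans (cong (fw a₀) (toℕ-fromℕ< lt)) (trans (fw-le a₀<N (m≤m+n a₀ q)) (m+n∸m≡n a₀ q))
    ... | no nlt = fromℕ< lt , trans (cong (fw a₀) (toℕ-fromℕ< lt)) (trans (fw-gt a₀<N wrapped<a₀) back)
      where
      N≤ : N ≤ a₀ + q
      N≤ = ≮⇒≥ nlt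
      lt : a₀ + q ∸ N < N
      lt = subst (a₀ + q ∸ N <_) (m+n∸n≡m N N) (∸-monoˡ-< (+-mono-< a₀<N q<N) N≤)
      wrapped<a₀ : a₀ + q ∸ N < a₀
      wrapped<a₀ = subst (a₀ + q ∸ N <_) (m+n∸n≡m a₀ N) (∸-monoˡ-< (+-monoʳ-< a₀ q<N) N≤)
      back : (a₀ + q ∸ N + N) ∸ a₀ ≡ q
      back = trans (cong (_∸ a₀) (m∸n+n≡m N≤)) (m+n∸m≡n a₀ q)

    -- Every window [q, q + k) with q ≤ k + 1 contains the position of a member of S: the
    -- boundary vertex at position q is in S, or a short arc through it ends inside the window.
    member-in-window : ∀ q → q ≤ suc k → Σ Vx λ s → s ∈ S × q ≤ pos s × pos s < q + k
    member-in-window q q≤1+k with column-at q (≤-<-trans q≤1+k 1+k<N)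
    ... | c , pc with boundary-vertex Fin.zero c (inj₁ refl)
    ...   | inj₁ mem = (Fin.zero , c) , mem , ≤-reflexive (sym pc) , subst (_< q + k) (sym pc) (m<m+n q k≥1)
    ...   | inj₂ (u , v , u∈ , v∈ , α≥1 , β≥1 , α+β≤k) =
            v , v∈ , place (subst (λ z → Carry (z + β) (pos v)) pc (fw-add a₀<N (toℕ<n c) (col<N v)))
      where
      β = fw (toℕ c) (col v)
      β<k : β < k
      β<k = ≤-trans (+-monoˡ-≤ β α≥1) α+β≤k
      q+β<N : q + β < N
      q+β<N = <-≤-trans (+-monoʳ-< q β<k) (≤-trans (+-monoˡ-≤ k q≤1+k) (≤-reflexive (sym N≡)))
      place : Carry (q + β) (pos v) → q ≤ pos v × pos v < q + k
      place (inj₁ e) = subst (q ≤_) e (m≤m+n q β) , subst (_< q + k) e (+-monoʳ-< q β<k)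
      place (inj₂ e) = ⊥-elim (<⇒≱ q+β<N (subst (N ≤_) (sym e) (m≤n+m N (pos v))))

    -- The member sL with the least positive position L (one exists in the window [1, k]).
    least-positive : Σ Vx λ sL → sL ∈ S × 1 ≤ pos sL × (∀ {z} → z ∈ S → 1 ≤ pos z → pos sL ≤ pos z)
    least-positive with least-such pos (λ s → 1 ≤ pos s) (λ s → 1 ≤? pos s) S | member-in-window 1 (s≤s z≤n)
    ... | inj₁ none | _ , s₁∈ , s₁≥1 , _ = ⊥-elim (none s₁∈ s₁≥1)
    ... | inj₂ found | _ = found

    -- If the column of sL is covered, the covering arc starts at s₀'s column (minimality of L)
    -- or beyond the wrap; either way its end v satisfies L < pos v ≤ k.
    after-least : ∀ {sL} → (∀ {z} → z ∈ S → 1 ≤ pos z → pos sL ≤ pos z) → Covered (col sL) →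
                  Σ Vx λ v → v ∈ S × pos sL < pos v × pos v ≤ k
    after-least {sL} least (u , v , u∈ , v∈ , α≥1 , β≥1 , α+β≤k) =
      v , v∈ , place (fw-add a₀<N (col<N sL) (col<N v))
      where
      L = pos sL
      α = fw (col u) (col sL)
      β = fw (col sL) (col v)
      L+β≤k : L + β ≤ k
      L+β≤k with fw-add a₀<N (col<N u) (col<N sL)
      ... | inj₁ e with 1 ≤? pos u
      ...   | yes pu≥1 = ⊥-elim (<⇒≱ (subst (pos u <_) e (m<m+n (pos u) α≥1)) (least u∈ pu≥1))
      ...   | no pu≱1 = ≤-trans (≤-reflexive (cong (_+ β)
                          (trans (sym e) (cong (_+ α) (n≤0⇒n≡0 (≤-pred (≰⇒> pu≱1))))))) α+β≤k
      L+β≤k | inj₂ e = <⇒≤ (+-cancelʳ-< N (L + β) k (begin-strict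
          L + β + N       ≡⟨ +-swapʳ L β N ⟩
          L + N + β       ≡⟨ cong (_+ β) (sym e) ⟩
          pos u + α + β   ≡⟨ +-assoc (pos u) α β ⟩
          pos u + (α + β) ≤⟨ +-monoʳ-≤ (pos u) α+β≤k ⟩
          pos u + k       <⟨ +-monoˡ-< k (fw-bound a₀<N (col<N u)) ⟩
          N + k           ≡⟨ +-comm N k ⟩
          k + N           ∎))
        where open ≤-Reasoning
      place : Carry (L + β) (pos v) → L < pos v × pos v ≤ k
      place (inj₁ e) = subst (L <_) e (m<m+n L β≥1) , subst (_≤ k) e L+β≤k
      place (inj₂ e) = ⊥-elim (<⇒≱ (≤-<-trans L+β≤k k<N) (subst (N ≤_) (sym e) (m≤n+m N (pos v))))

    -- If the column of sH is covered, the covering arc must wrap past s₀'s column after sH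
    -- (maximality of H), so its start u satisfies k + 1 ≤ pos u < H.
    before-greatest : ∀ {sH} → (∀ {z} → z ∈ S → pos z ≤ pos sH) → Covered (col sH) →
                      Σ Vx λ u → u ∈ S × suc k ≤ pos u × pos u < pos sH
    before-greatest {sH} top (u , v , u∈ , v∈ , α≥1 , β≥1 , α+β≤k) =
      u , u∈ , place (fw-add a₀<N (col<N sH) (col<N v)) (fw-add a₀<N (col<N u) (col<N sH))
      where
      H = pos sH
      α = fw (col u) (col sH)
      β = fw (col sH) (col v)
      place : Carry (H + β) (pos v) → Carry (pos u + α) H → suc k ≤ pos u × pos u < H
      place (inj₁ e) _ = ⊥-elim (<⇒≱ (subst (H <_) e (m<m+n H β≥1)) (top v∈))
      place (inj₂ eB) (inj₂ eA) = ⊥-elim (<⇒≱ (+-mono-< (fw-bound a₀<N (col<N u)) (≤-<-trans α+β≤k k<N)) (begin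
        N + N           ≤⟨ m≤n+m (N + N) (pos v) ⟩
        pos v + (N + N) ≡⟨ sym (+-assoc (pos v) N N) ⟩
        pos v + N + N   ≡⟨ cong (_+ N) (sym eB) ⟩
        H + β + N       ≡⟨ +-swapʳ H β N ⟩
        H + N + β       ≡⟨ cong (_+ β) (sym eA) ⟩
        pos u + α + β   ≡⟨ +-assoc (pos u) α β ⟩
        pos u + (α + β) ∎))
        where open ≤-Reasoning
      place (inj₂ eB) (inj₁ eA) = +-cancelʳ-≤ k (suc k) (pos u) (begin
        suc k + k       ≡⟨ sym N≡ ⟩
        N               ≤⟨ m≤n+m N (pos v) ⟩
        pos v + N       ≡⟨ sym eB ⟩
        H + β           ≡⟨ cong (_+ β) (sym eA) ⟩
        pos u + α + β   ≡⟨ +-assoc (pos u) α β ⟩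
        pos u + (α + β) ≤⟨ +-monoʳ-≤ (pos u) α+β≤k ⟩
        pos u + k       ∎) , subst (pos u <_) eA (m<m+n (pos u) α≥1)
        where open ≤-Reasoning

    InBand : ℕ → ℕ → Vx → Set
    InBand lo hi s = lo ≤ pos s × pos s ≤ hi

    TwoInBand : ℕ → ℕ → Set
    TwoInBand lo hi = Σ Vx λ x → Σ Vx λ y → x ≢ y × x ∈ S × y ∈ S × InBand lo hi x × InBand lo hi y

    boundary-pair-≢ : ∀ {c : Fin N} → _≢_ {A = Vx} (Fin.zero , c) (rM , c)
    boundary-pair-≢ e = <-irrefl refl (subst (1 ≤_) (trans (sym (toℕ-fromℕ M)) (sym (cong row e))) M≥1)

    low-pair-at : ∀ {sL} → sL ∈ S → 1 ≤ pos sL → pos sL ≤ k → (∀ {z} → z ∈ S → 1 ≤ pos z → pos sL ≤ pos z) →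
                  ((Fin.zero , proj₂ sL) ∈ S × (rM , proj₂ sL) ∈ S) ⊎ Covered (col sL) → TwoInBand 1 k
    low-pair-at _ L≥1 L≤k _ (inj₁ (m₀ , mM)) = _ , _ , boundary-pair-≢ , m₀ , mM , (L≥1 , L≤k) , (L≥1 , L≤k)
    low-pair-at {sL} sL∈ L≥1 L≤k least (inj₂ cov) with after-least {sL} least cov
    ... | v , v∈ , L<v , v≤k = sL , v , pos-≢ L<v , sL∈ , v∈ , (L≥1 , L≤k) , (≤-trans L≥1 (<⇒≤ L<v) , v≤k)

    low-pair : TwoInBand 1 k
    low-pair = from-least least-positive (member-in-window 1 (s≤s z≤n))
      where
      from-least : Σ Vx (λ sL → sL ∈ S × 1 ≤ pos sL × (∀ {z} → z ∈ S → 1 ≤ pos z → pos sL ≤ pos z)) →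
                   Σ Vx (λ s → s ∈ S × 1 ≤ pos s × pos s < 1 + k) → TwoInBand 1 k
      from-least (sL , sL∈ , L≥1 , least) (_ , s₁∈ , s₁≥1 , s₁<1+k) =
        low-pair-at sL∈ L≥1 (≤-trans (least s₁∈ s₁≥1) (≤-pred s₁<1+k)) least (column-cases (proj₂ sL))

    high-pair-at : ∀ {sH} → sH ∈ S → suc k ≤ pos sH → (∀ {z} → z ∈ S → pos z ≤ pos sH) →
                   ((Fin.zero , proj₂ sH) ∈ S × (rM , proj₂ sH) ∈ S) ⊎ Covered (col sH) → TwoInBand (suc k) N
    high-pair-at {sH} _ H≥1+k _ (inj₁ (m₀ , mM)) =
      _ , _ , boundary-pair-≢ , m₀ , mM , (H≥1+k , H≤N) , (H≥1+k , H≤N)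
      where
      H≤N : pos sH ≤ N
      H≤N = <⇒≤ (fw-bound a₀<N (col<N sH))
    high-pair-at {sH} sH∈ H≥1+k top (inj₂ cov) with before-greatest {sH} top cov
    ... | u , u∈ , u≥1+k , u<H = u , sH , pos-≢ u<H , u∈ , sH∈ ,
          (u≥1+k , ≤-trans (<⇒≤ u<H) H≤N) , (H≥1+k , H≤N)
      where
      H≤N : pos sH ≤ N
      H≤N = <⇒≤ (fw-bound a₀<N (col<N sH))

    high-pair : TwoInBand (suc k) N
    high-pair = from-greatest (greatest pos S s₀∈) (member-in-window (suc k) ≤-refl)
      where
      from-greatest : Σ Vx (λ sH → sH ∈ S × (∀ {z} → z ∈ S → pos z ≤ pos sH)) →
                      Σ Vx (λ s → s ∈ S × suc k ≤ pos s × pos s < suc k + k) → TwoInBand (suc k) N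
      from-greatest (sH , sH∈ , top) (_ , s₂∈ , s₂≥1+k , _) =
        high-pair-at sH∈ (≤-trans s₂≥1+k (top s₂∈)) top (column-cases (proj₂ sH))

    five-members : 5 ≤ length S
    five-members = five low-pair high-pair
      where
      five : TwoInBand 1 k → TwoInBand (suc k) N → 5 ≤ length S
      five (x₁ , y₁ , x₁≢y₁ , x₁∈ , y₁∈ , bx₁ , by₁) (x₂ , y₂ , x₂≢y₂ , x₂∈ , y₂∈ , bx₂ , by₂) =
        distinct-length (s₀ ∷ x₁ ∷ y₁ ∷ x₂ ∷ y₂ ∷ []) S
          ((after-s₀ (proj₁ bx₁) ∷ after-s₀ (proj₁ by₁) ∷
            after-s₀ (≤-trans (s≤s z≤n) (proj₁ bx₂)) ∷ after-s₀ (≤-trans (s≤s z≤n) (proj₁ by₂)) ∷ []) ∷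
           (x₁≢y₁ ∷ low≢high bx₁ bx₂ ∷ low≢high bx₁ by₂ ∷ []) ∷
           (low≢high by₁ bx₂ ∷ low≢high by₁ by₂ ∷ []) ∷
           (x₂≢y₂ ∷ []) ∷ [] ∷ [])
          (s₀∈ ∷ x₁∈ ∷ y₁∈ ∷ x₂∈ ∷ y₂∈ ∷ [])
        where
        after-s₀ : ∀ {x} → 1 ≤ pos x → s₀ ≢ x
        after-s₀ {x} h = pos-≢ (subst (_< pos x) (sym pos-s₀) h)
        low≢high : ∀ {x y} → InBand 1 k x → InBand (suc k) N y → x ≢ y
        low≢high bx by = pos-≢ (≤-trans (s≤s (proj₂ bx)) (proj₁ by))

proposition9 : ∀ (m k : ℕ) → 2 ≤ m → 2 ≤ k →
    GeodeticNumberBetween (P m ⊠ C (suc (2 * k))) 5 6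
proposition9 (suc M) k (s≤s M≥1) k≥2 =
    (λ S _ geodetic → LowerBound.five-members M k M≥1 k≥1 S geodetic)
  , (S6 , S6-unique , S6-geodetic , ≤-refl)
  where
  k≥1 : 1 ≤ k
  k≥1 = ≤-trans (s≤s z≤n) k≥2
  open UpperBound M k M≥1 k≥1 using (S6; S6-unique; S6-geodetic)
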